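{- Let $S=\{R_0,\ldots,R_d\}$ be an association scheme on a nonempty finite set $X$, $\mathbb{F}$ a field, $x\in X$, $a\ge0$ an integer, and $i_b,j_b,\ell_b\in\{0,\ldots,d\}$ for $b=0,\ldots,a$ with $p_{i_bj_b}^{\ell_b}=1$ for all $b$. Then $E_{i_0}^*A_{j_0}E_{\ell_0}^*E_{i_1}^*A_{j_1}E_{\ell_1}^*\cdots E_{i_a}^*A_{j_a}E_{\ell_a}^*$ is a $(0,1)$-matrix.
   Context: An association scheme on $X$ is a partition $S=\{R_0,\ldots,R_d\}$ of $X\times X$ into nonempty relations with $R_0$ the diagonal, closed under transposes, with intersection numbers $p_{ij}^k=|\{\ell:(m,\ell)\in R_i,(\ell,n)\in R_j\}|$ independent of $(m,n)\in R_k$. $xR_i=\{z:(x,z)\in R_i\}$. $A_j\in M_X(\mathbb{F})$ is the $(0,1)$ adjacency matrix of $R_j$, $E_i^*$ the diagonal $(0,1)$-matrix with $(y,y)$-entry $1$ iff $y\in xR_i$. -}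

module Defs where

open import Level using (Level; _⊔_)
open import Data.Nat using (ℕ; zero; suc)
open import Data.Fin using (Fin; zero; suc; _≟_)
open import Data.Product using (Σ; ∃; ∃₂; _×_; _,_)
open import Relation.Nullary using (¬_; Dec; yes; no)
open import Relation.Nullary.Decidable using (⌊_⌋)
open import Relation.Binary.PropositionalEquality using (_≡_)
open import Data.Bool using (Bool; true; false; if_then_else_)
open import Algebra.Bundles using (CommutativeRing)
import Data.Sum
import Data.Bool

record Field (c ℓ : Level) : Set (Level.suc (c ⊔ ℓ)) where
  field
    commutativeRing : CommutativeRing c ℓ
  open CommutativeRing commutativeRing public
  field
    0≉1     : ¬ (0# ≈ 1#)
    inverse : ∀ x → ¬ (x ≈ 0#) → Σ Carrier λ y → (x * y) ≈ 1#

count : ∀ {n} → (Fin n → Bool) → ℕ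
count {zero}  p = zero
count {suc n} p with p zero
... | true  = suc (count (λ k → p (suc k)))
... | false = count (λ k → p (suc k))

-- A relation partition is encoded by the map  rel : X → X → Fin (suc d),
-- rel x y = i  iff  (x , y) ∈ R_i.  (This is exactly a partition of X×X
-- into the d+1 labelled classes R_i = rel⁻¹(i).)

record AssociationScheme (n d : ℕ) : Set where
  field
    rel        : Fin n → Fin n → Fin (suc d)
    nonempty   : ∀ i → ∃₂ λ x y → rel x y ≡ i
    diagonal   : ∀ x y → (rel x y ≡ zero → x ≡ y) × (x ≡ y → rel x y ≡ zero)
    transpose  : Fin (suc d) → Fin (suc d)
    transpose-spec : ∀ x y → rel y x ≡ transpose (rel x y)
    p          : Fin (suc d) → Fin (suc d) → Fin (suc d) → ℕ
    p-spec     : ∀ i j k m m' → rel m m' ≡ k →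
                 count (λ l → ⌊ rel m l ≟ i ⌋ Data.Bool.∧ ⌊ rel l m' ≟ j ⌋) ≡ p i j k

module Matrices {c ℓ} (F : Field c ℓ) where
  open Field F using (Carrier; _≈_; _+_; _*_; 0#; 1#)

  Matrix : ℕ → Set c
  Matrix n = Fin n → Fin n → Carrier

  sumF : ∀ {n} → (Fin n → Carrier) → Carrier
  sumF {zero}  f = 0#
  sumF {suc n} f = f zero + sumF (λ k → f (suc k))

  _·_ : ∀ {n} → Matrix n → Matrix n → Matrix n
  (M · N) y z = sumF (λ w → M y w * N w z)

  chain : ∀ {n} (a : ℕ) → (Fin (suc a) → Matrix n) → Matrix n
  chain zero    M = M zero
  chain (suc a) M = M zero · chain a (λ b → M (suc b))

  indicator : Bool → Carrier
  indicator true  = 1#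
  indicator false = 0#

  IsZeroOne : ∀ {n} → Matrix n → Set ℓ
  IsZeroOne {n} M = ∀ y z → (M y z ≈ 0#) Data.Sum.⊎ (M y z ≈ 1#)

  module _ {n d} (S : AssociationScheme n d) where
    open AssociationScheme S

    A : Fin (suc d) → Matrix n
    A j y z = indicator ⌊ rel y z ≟ j ⌋

    E* : Fin n → Fin (suc d) → Matrix n
    E* x i y z = indicator (⌊ y ≟ z ⌋ Data.Bool.∧ ⌊ rel x y ≟ i ⌋)

-- Each factor E*_i A_j E*_l has, in every column z, the entries
-- [x R_i y] [y R_j z] [x R_l z]; when x R_l z, exactly p^l_{ij} = 1 of them
-- are 1, and otherwise none is.  So every column of every factor is zero or a
-- standard unit vector.  That property is closed under matrix products (column
-- z of M N is column w of M when column z of N is the w-th unit vector) and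
-- implies that the matrix is a (0,1)-matrix.
module Submission where

open import Defs
open import Data.Nat using (ℕ; suc)
open import Data.Fin using (Fin)
open import Relation.Binary.PropositionalEquality using (_≡_)

open import Data.Bool using (Bool; true; false; _∧_)
open import Data.Fin using (zero; suc; _≟_)
open import Data.Fin.Properties using (suc-injective)
open import Data.Nat.Properties using () renaming (suc-injective to ℕ-suc-injective)
open import Data.Product using (Σ; _,_; _×_)
open import Data.Sum using (_⊎_; inj₁; inj₂)
open import Data.Empty using (⊥-elim)
open import Relation.Nullary using (¬_; yes; no)
open import Relation.Nullary.Decidable using (⌊_⌋)
open import Relation.Binary.PropositionalEquality using (refl; cong; cong₂)
import Relation.Binary.PropositionalEquality as ≡

count≡0⇒false : ∀ {n} (q : Fin n → Bool) → count q ≡ 0 → ∀ y → q y ≡ false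
count≡0⇒false {suc n} q h y with q zero in q₀
count≡0⇒false {suc n} q () y       | true
count≡0⇒false {suc n} q h zero    | false = q₀
count≡0⇒false {suc n} q h (suc y) | false = count≡0⇒false (λ k → q (suc k)) h y

count≡1⇒unique : ∀ {n} (q : Fin n → Bool) → count q ≡ 1 →
                 Σ (Fin n) λ w → q w ≡ true × (∀ y → ¬ y ≡ w → q y ≡ false)
count≡1⇒unique {suc n} q h with q zero in q₀
... | true = zero , q₀ , λ
  { zero    y≢0 → ⊥-elim (y≢0 refl)
  ; (suc y) _   → count≡0⇒false (λ k → q (suc k)) (ℕ-suc-injective h) y }
... | false with count≡1⇒unique (λ k → q (suc k)) h
... | w , qw , off = suc w , qw , λ
  { zero    _   → q₀
  ; (suc y) y≢w → off y (λ y≡w → y≢w (cong suc y≡w)) }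

module _ {c ℓ} (F : Field c ℓ) where
  open Field F hiding (refl; zero)
  open Field F using () renaming (refl to ≈-refl)
  open Matrices F
  open import Relation.Binary.Reasoning.Setoid setoid

  IsUnitVector : ∀ {n} → (Fin n → Carrier) → Set ℓ
  IsUnitVector {n} v = Σ (Fin n) λ w → v w ≈ 1# × (∀ y → ¬ y ≡ w → v y ≈ 0#)

  ZeroOrUnit : ∀ {n} → (Fin n → Carrier) → Set ℓ
  ZeroOrUnit v = (∀ y → v y ≈ 0#) ⊎ IsUnitVector v

  ColumnsZeroOrUnit : ∀ {n} → Matrix n → Set ℓ
  ColumnsZeroOrUnit M = ∀ z → ZeroOrUnit (λ y → M y z)

  zeroOrUnit-resp : ∀ {n} {u v : Fin n → Carrier} → (∀ y → v y ≈ u y) →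
                    ZeroOrUnit u → ZeroOrUnit v
  zeroOrUnit-resp v≈u (inj₁ u≈0) = inj₁ (λ y → trans (v≈u y) (u≈0 y))
  zeroOrUnit-resp v≈u (inj₂ (w , uw≈1 , off)) =
    inj₂ (w , trans (v≈u w) uw≈1 , λ y y≢w → trans (v≈u y) (off y y≢w))

  sumF-zero : ∀ {n} (f : Fin n → Carrier) → (∀ k → f k ≈ 0#) → sumF f ≈ 0#
  sumF-zero {ℕ.zero} f f≈0 = ≈-refl
  sumF-zero {suc n}  f f≈0 = begin
    f zero + sumF (λ k → f (suc k)) ≈⟨ +-cong (f≈0 zero) (sumF-zero _ (λ k → f≈0 (suc k))) ⟩
    0# + 0#                         ≈⟨ +-identityˡ 0# ⟩
    0#                              ∎

  sumF-single : ∀ {n} (f : Fin n → Carrier) (w : Fin n) →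
                (∀ k → ¬ k ≡ w → f k ≈ 0#) → sumF f ≈ f w
  sumF-single {suc n} f zero off = begin
    f zero + sumF (λ k → f (suc k)) ≈⟨ +-congˡ (sumF-zero _ (λ k → off (suc k) (λ ()))) ⟩
    f zero + 0#                     ≈⟨ +-identityʳ (f zero) ⟩
    f zero                          ∎
  sumF-single {suc n} f (suc w) off = begin
    f zero + sumF (λ k → f (suc k)) ≈⟨ +-cong (off zero (λ ())) (sumF-single _ w off′) ⟩
    0# + f (suc w)                  ≈⟨ +-identityˡ (f (suc w)) ⟩
    f (suc w)                       ∎
    where
    off′ : ∀ k → ¬ k ≡ w → f (suc k) ≈ 0#
    off′ k k≢w = off (suc k) (λ sk≡sw → k≢w (suc-injective sk≡sw))

  ·-columnsZeroOrUnit : ∀ {n} (M N : Matrix n) →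
                        ColumnsZeroOrUnit M → ColumnsZeroOrUnit N → ColumnsZeroOrUnit (M · N)
  ·-columnsZeroOrUnit M N colM colN z with colN z
  ... | inj₁ Nz≈0 = inj₁ λ y → sumF-zero _ (λ w → trans (*-congˡ (Nz≈0 w)) (zeroʳ _))
  ... | inj₂ (w , Nwz≈1 , off) = zeroOrUnit-resp MNyz≈Myw (colM w)
    where
    MNyz≈Myw : ∀ y → (M · N) y z ≈ M y w
    MNyz≈Myw y = begin
      (M · N) y z  ≈⟨ sumF-single _ w (λ u u≢w → trans (*-congˡ (off u u≢w)) (zeroʳ _)) ⟩
      M y w * N w z ≈⟨ *-congˡ Nwz≈1 ⟩
      M y w * 1#    ≈⟨ *-identityʳ _ ⟩
      M y w         ∎

  chain-columnsZeroOrUnit : ∀ {n} (a : ℕ) (M : Fin (suc a) → Matrix n) →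
                            (∀ b → ColumnsZeroOrUnit (M b)) → ColumnsZeroOrUnit (chain a M)
  chain-columnsZeroOrUnit ℕ.zero  M colM = colM zero
  chain-columnsZeroOrUnit (suc a) M colM =
    ·-columnsZeroOrUnit _ _ (colM zero) (chain-columnsZeroOrUnit a _ (λ b → colM (suc b)))

  columnsZeroOrUnit⇒isZeroOne : ∀ {n} (M : Matrix n) → ColumnsZeroOrUnit M → IsZeroOne M
  columnsZeroOrUnit⇒isZeroOne M colM y z with colM z
  ... | inj₁ Mz≈0 = inj₁ (Mz≈0 y)
  ... | inj₂ (w , Mwz≈1 , off) with y ≟ w
  ...   | yes refl = inj₂ Mwz≈1
  ...   | no y≢w  = inj₁ (off y y≢w)

  indicator-∧ : ∀ s t → indicator s * indicator t ≈ indicator (s ∧ t)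
  indicator-∧ true  t = *-identityˡ _
  indicator-∧ false t = zeroˡ _

  count≡1⇒unitVector : ∀ {n} (q : Fin n → Bool) → count q ≡ 1 →
                       IsUnitVector (λ y → indicator (q y))
  count≡1⇒unitVector q h with count≡1⇒unique q h
  ... | w , qw , off = w , indicator-true qw , λ y y≢w → indicator-false (off y y≢w)
    where
    indicator-true : ∀ {s} → s ≡ true → indicator s ≈ 1#
    indicator-true refl = ≈-refl
    indicator-false : ∀ {s} → s ≡ false → indicator s ≈ 0#
    indicator-false refl = ≈-refl

  IsDiagonal : ∀ {n} → Matrix n → Set ℓ
  IsDiagonal D = ∀ y u → ¬ y ≡ u → D y u ≈ 0#

  diagonal-·ˡ : ∀ {n} (D N : Matrix n) → IsDiagonal D → ∀ y z → (D · N) y z ≈ D y y * N y z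
  diagonal-·ˡ D N diagD y z =
    sumF-single _ y (λ u u≢y → trans (*-congʳ (diagD y u (λ y≡u → u≢y (≡.sym y≡u)))) (zeroˡ _))

  diagonal-·ʳ : ∀ {n} (N D : Matrix n) → IsDiagonal D → ∀ y z → (N · D) y z ≈ N y z * D z z
  diagonal-·ʳ N D diagD y z =
    sumF-single _ z (λ u u≢z → trans (*-congˡ (diagD u z u≢z)) (zeroʳ _))

  module _ {n d} (S : AssociationScheme n d) (x : Fin n) where
    open AssociationScheme S

    E*-diagonal : ∀ i → IsDiagonal (E* S x i)
    E*-diagonal i y u y≢u with y ≟ u
    ... | yes y≡u = ⊥-elim (y≢u y≡u)
    ... | no _    = ≈-refl

    E*-diag-entry : ∀ i y → E* S x i y y ≡ indicator ⌊ rel x y ≟ i ⌋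
    E*-diag-entry i y with y ≟ y
    ... | yes _   = refl
    ... | no y≢y = ⊥-elim (y≢y refl)

    sandwich-entry : ∀ i j l y z →
      ((E* S x i · A S j) · E* S x l) y z
        ≈ indicator (⌊ rel x y ≟ i ⌋ ∧ ⌊ rel y z ≟ j ⌋) * indicator ⌊ rel x z ≟ l ⌋
    sandwich-entry i j l y z = begin
      ((E* S x i · A S j) · E* S x l) y z
        ≈⟨ diagonal-·ʳ (E* S x i · A S j) _ (E*-diagonal l) y z ⟩
      (E* S x i · A S j) y z * E* S x l z z
        ≈⟨ *-congʳ (diagonal-·ˡ _ (A S j) (E*-diagonal i) y z) ⟩
      (E* S x i y y * A S j y z) * E* S x l z z
        ≡⟨ cong₂ (λ s t → (s * A S j y z) * t) (E*-diag-entry i y) (E*-diag-entry l z) ⟩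
      (indicator ⌊ rel x y ≟ i ⌋ * indicator ⌊ rel y z ≟ j ⌋) * indicator ⌊ rel x z ≟ l ⌋
        ≈⟨ *-congʳ (indicator-∧ ⌊ rel x y ≟ i ⌋ ⌊ rel y z ≟ j ⌋) ⟩
      indicator (⌊ rel x y ≟ i ⌋ ∧ ⌊ rel y z ≟ j ⌋) * indicator ⌊ rel x z ≟ l ⌋
        ∎

    sandwich-columnsZeroOrUnit : ∀ i j l → p i j l ≡ 1 →
                                 ColumnsZeroOrUnit ((E* S x i · A S j) · E* S x l)
    -- Abstracting the entry equation alongside the decision makes its last factor reduce to 1# or 0#.
    sandwich-columnsZeroOrUnit i j l pijl≡1 z with rel x z ≟ l | (λ y → sandwich-entry i j l y z)
    ... | no _  | entry = inj₁ λ y → trans (entry y) (zeroʳ _)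
    ... | yes xz∈Rl | entry =
      zeroOrUnit-resp (λ y → trans (entry y) (*-identityʳ _))
        (inj₂ (count≡1⇒unitVector _ (≡.trans (p-spec i j l x z xz∈Rl) pijl≡1)))

lemma3p8 : ∀ {c ℓ} (F : Field c ℓ) (n d : ℕ) → (S : AssociationScheme n d) →
           (x : Fin n) (a : ℕ) (i j l : Fin (suc a) → Fin (suc d)) →
           (∀ b → AssociationScheme.p S (i b) (j b) (l b) ≡ 1) →
           Matrices.IsZeroOne F
             (Matrices.chain F a (λ b → Matrices._·_ F
               (Matrices._·_ F (Matrices.E* F S x (i b)) (Matrices.A F S (j b)))
               (Matrices.E* F S x (l b))))
lemma3p8 F n d S x a i j l p≡1 =
  columnsZeroOrUnit⇒isZeroOne F _
    (chain-columnsZeroOrUnit F a _ λ b →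
      sandwich-columnsZeroOrUnit F S x (i b) (j b) (l b) (p≡1 b))
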